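{- Let $Q$ be an HDA. For every rooted path $\pi$ in $Q$, the pair $(S_\pi,T_\pi)$ is an ST-configuration, i.e. $T_\pi\subseteq S_\pi$.
   Context: Precubical sets: families of disjoint sets $Q_n$ with face maps $s_k,t_k:Q_n\to Q_{n-1}$ ($k=1,\dots,n$) satisfying $\alpha_k\beta_\ell=\beta_{\ell-1}\alpha_k$ for $\alpha,\beta\in\{s,t\}$, $k<\ell$. An HDA is a finite precubical set with initial cell $I\in Q_0$. A step is $q'\xrightarrow{s_i}q$ with $s_iq=q'$, or $q\xrightarrow{t_i}q'$ with $t_iq=q'$; a path is a sequence of consecutive steps; a rooted path starts at $I$. Universal labels: $\approx$ is the equivalence on $Q_1$ generated by $(s_iq,t_iq)$, $q\in Q_2$, $i\in\{1,2\}$; $\mathcal U(Q)=Q_1/\approx$, $\lambda(e)$ the class of $e$; for $q\in Q_n$, $\lambda_i(q)=\lambda(s_1\cdots s_{i-1}s_{i+1}\cdots s_n(q))$. For a rooted path $\pi$ define $(S_\pi,T_\pi)$, subsets of $\mathcal U(Q)$: the trivial path at $I$ gets $(\emptyset,\emptyset)$; if $\pi=\pi'\xrightarrow{s_i}q$ then $S_\pi=S_{\pi'}\cup\{\lambda_i(q)\}$, $T_\pi=T_{\pi'}$; if $\pi=\pi'\xrightarrow{t_i}t_i(q')$ with $q'$ the end of $\pi'$, then $S_\pi=S_{\pi'}$, $T_\pi=T_{\pi'}\cup\{\lambda_i(q')\}$. -}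

module Defs where

open import Level using (Level; _⊔_) renaming (suc to lsuc; zero to lzero)
open import Data.Nat using (ℕ; zero; suc; pred; _<_)
open import Data.Fin using (Fin; zero; suc; toℕ; inject₁; fromℕ)
open import Data.Maybe using (Maybe; just; nothing)
import Data.Maybe as Maybe
open import Data.Product using (Σ; ∃; _×_; _,_)
open import Data.Sum using (_⊎_)
open import Data.Empty using (⊥)
open import Function.Bundles using (_↔_)
open import Relation.Nullary using (¬_)
open import Relation.Binary.PropositionalEquality using (_≡_)
open import Relation.Binary.Construct.Closure.Equivalence using (EqClosure)

data FaceKind : Set where
  s t : FaceKind

-- Cells of dimension n form the type Cell n (so the
-- family is automatically disjoint).  Face maps Q_{n+1} → Q_n are
-- δ α n k with k : Fin (suc n) the ZERO-BASED index, i.e. k represents the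
-- paper's index toℕ k + 1 ∈ {1,…,n+1}.
record PrecubicalSet : Set₁ where
  field
    Cell : ℕ → Set
    δ    : FaceKind → (n : ℕ) → Fin (suc n) → Cell (suc n) → Cell n
    -- precubical identity  α_k β_ℓ = β_{ℓ-1} α_k  for k < ℓ
    -- (on Q_{n+2}; k zero-based in Fin (n+1) for the outer map, ℓ zero-based
    -- in Fin (n+2), ℓ' the zero-based index of ℓ-1).
    cubical : ∀ (α β : FaceKind) (n : ℕ) (k : Fin (suc n)) (ℓ : Fin (suc (suc n)))
                (ℓ' : Fin (suc n)) (x : Cell (suc (suc n))) →
              toℕ k < toℕ ℓ → toℕ ℓ' ≡ pred (toℕ ℓ) →
              δ α n k (δ β (suc n) ℓ x) ≡ δ β n ℓ' (δ α (suc n) (inject₁ k) x)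

record IsFinite (P : PrecubicalSet) : Set where
  open PrecubicalSet P
  field
    size      : ℕ → ℕ
    enumerate : (n : ℕ) → Cell n ↔ Fin (size n)
    dimBound  : ℕ
    noHigh    : (n : ℕ) → dimBound < n → ¬ Cell n

record HDA : Set₁ where
  field
    precubical : PrecubicalSet
    finite     : IsFinite precubical
  open PrecubicalSet precubical public
  field
    I : Cell 0

module _ (Q : HDA) where
  open HDA Q

  data Gen : Cell 1 → Cell 1 → Set where
    gen : (q : Cell 2) (i : Fin 2) → Gen (δ s 1 i q) (δ t 1 i q)

  -- The equivalence ≈ generated by Gen; U(Q) = Q_1/≈ is represented by
  -- Q_1 up to ≈ (setoid), and λ(e) is e viewed up to ≈.
  _≈_ : Cell 1 → Cell 1 → Set
  _≈_ = EqClosure Gen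

  unlast : ∀ {n} → Fin (suc n) → Maybe (Fin n)
  unlast {zero}  zero    = nothing
  unlast {suc n} zero    = just zero
  unlast {suc n} (suc i) = Maybe.map suc (unlast i)

  -- Helper:
  -- dropLower m q = s_1 ⋯ s_m (q) for q ∈ Q_{m+1}.
  dropLower : (m : ℕ) → Cell (suc m) → Cell 1
  dropLower zero    q = q
  dropLower (suc m) q = dropLower m (δ s (suc m) (inject₁ (fromℕ m)) q)

  -- faceEdge n k q = s_1 ⋯ s_{i-1} s_{i+1} ⋯ s_{n+1} (q) for q ∈ Q_{n+1},
  -- where i = toℕ k + 1.
  faceEdge : (n : ℕ) → Fin (suc n) → Cell (suc n) → Cell 1
  faceEdge zero    zero q = q
  faceEdge (suc m) k    q with unlast k
  ... | nothing = dropLower (suc m) q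
  ... | just k' = faceEdge m k' (δ s (suc m) (fromℕ (suc m)) q)

  data RootedPath : (n : ℕ) → Cell n → Set where
    root : RootedPath 0 I
    up   : ∀ {n q'} → RootedPath n q' → (i : Fin (suc n)) (q : Cell (suc n)) →
           δ s n i q ≡ q' → RootedPath (suc n) q
    down : ∀ {n q'} → RootedPath (suc n) q' → (i : Fin (suc n)) →
           RootedPath n (δ t n i q')

  -- Subsets of U(Q) = Q_1/≈, given as predicates on Q_1 (membership of the
  -- class of an edge).  S_π and T_π:
  Sπ : ∀ {n q} → RootedPath n q → Cell 1 → Set
  Sπ root            e = ⊥
  Sπ (up π i q _)    e = Sπ π e ⊎ (e ≈ faceEdge _ i q)
  Sπ (down π i)      e = Sπ π e

  Tπ : ∀ {n q} → RootedPath n q → Cell 1 → Set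
  Tπ root                  e = ⊥
  Tπ (up π i q _)          e = Tπ π e
  Tπ (down {q' = q'} π i)  e = Tπ π e ⊎ (e ≈ faceEdge _ i q')

  IsSTConfiguration : (Cell 1 → Set) → (Cell 1 → Set) → Set
  IsSTConfiguration S T = ∀ e → T e → S e

module Submission where

-- Every edge label λ_J(q) of a cell q is, up to ≈, independent
-- of HOW q is cut down to an edge in direction J: any composite of faces
-- (of either kind, in any order) that keeps coordinate J lands in the same
-- ≈-class.  We capture such composites by the inductive relation EdgeOf and
-- prove this uniqueness by induction on the dimension; the inductive step
-- compares two faces of q through a common lower face (the precubical
-- identities in the symmetric form 'faceSwap'), and the generators of ≈
-- settle the two opposite faces of a square.  Consequently
--   λ_j(δ_α,i q) ≈ λ_{punchIn i j}(q)              ('faceLabel'),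
-- i.e. labels are inherited by faces.  Along a rooted path this shows that
-- every label of the current cell already lies in S_π ('labelsInS'), and a
-- t-step only ever adds to T_π a label of the cell it leaves; hence T_π ⊆ S_π.

open import Defs
open import Data.Nat using (ℕ; zero; suc; pred; s≤s) renaming (_<_ to _<ℕ_)
open import Data.Fin using (Fin; zero; suc; toℕ; inject₁; fromℕ; punchIn; punchOut; _<_)
open import Data.Fin.Properties
  using (_≟_; <-cmp; toℕ-inject₁; punchIn-injective; punchInᵢ≢i; punchIn-punchOut)
open import Data.Maybe using (just; nothing)
open import Data.Maybe.Properties using (just-injective)
open import Data.Sum using (inj₁; inj₂)
open import Data.Empty using (⊥-elim)
open import Data.Unit using (⊤; tt)
open import Function using (_∘_)
open import Relation.Nullary using (yes; no)
open import Relation.Binary.Definitions using (tri<; tri≈; tri>)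
open import Relation.Binary.PropositionalEquality
  using (_≡_; _≢_; refl; sym; trans; cong; subst; module ≡-Reasoning)
open import Relation.Binary.Construct.Closure.ReflexiveTransitive using (ε; _◅_; _◅◅_)
open import Relation.Binary.Construct.Closure.Symmetric using (bwd)
open import Relation.Binary.Construct.Closure.Equivalence using (symmetric)

-- Index combinatorics.  Removing coordinate a from a cube renumbers the
-- remaining coordinates by punchOut; coordinate j of the face is coordinate
-- punchIn a j of the cube.

inject₁-punchOut : ∀ {n} {a b : Fin (suc n)} (a≢b : a ≢ b) → b < a →
                   inject₁ (punchOut a≢b) ≡ b
inject₁-punchOut {suc n} {suc a} {zero}  a≢b b<a       = refl
inject₁-punchOut {suc n} {suc a} {suc b} a≢b (s≤s b<a) =
  cong suc (inject₁-punchOut (a≢b ∘ cong suc) b<a)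

suc-punchOut : ∀ {n} {a b : Fin (suc n)} (b≢a : b ≢ a) → b < a →
               suc (toℕ (punchOut b≢a)) ≡ toℕ a
suc-punchOut {n}     {suc a} {zero}  b≢a b<a       = refl
suc-punchOut {suc n} {suc a} {suc b} b≢a (s≤s b<a) =
  cong suc (suc-punchOut (b≢a ∘ cong suc) b<a)

punchIn-commute : ∀ {n} {a b : Fin (suc (suc n))} (a≢b : a ≢ b) (b≢a : b ≢ a) (j : Fin n) →
                  punchIn a (punchIn (punchOut a≢b) j) ≡ punchIn b (punchIn (punchOut b≢a) j)
punchIn-commute {n}     {zero}  {zero}  a≢b b≢a j = ⊥-elim (a≢b refl)
punchIn-commute {n}     {zero}  {suc b} a≢b b≢a j = refl
punchIn-commute {n}     {suc a} {zero}  a≢b b≢a j = refl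
punchIn-commute {zero}  {suc zero} {suc zero} a≢b b≢a ()
punchIn-commute {suc n} {suc a} {suc b} a≢b b≢a zero    = refl
punchIn-commute {suc n} {suc a} {suc b} a≢b b≢a (suc j) =
  cong suc (punchIn-commute (a≢b ∘ cong suc) (b≢a ∘ cong suc) j)

punchIn-penultimate : ∀ n → punchIn (inject₁ (fromℕ n)) (fromℕ n) ≡ fromℕ (suc n)
punchIn-penultimate zero    = refl
punchIn-penultimate (suc n) = cong suc (punchIn-penultimate n)

module Labels (Q : HDA) where
  open HDA Q

  unlast-just : ∀ {n} (J : Fin (suc n)) {j} →
                unlast Q J ≡ just j → punchIn (fromℕ n) j ≡ J
  unlast-just {suc n} zero    refl = refl
  unlast-just {suc n} (suc J) eq with unlast Q J in eqJ
  ... | just j rewrite sym (just-injective eq) = cong suc (unlast-just J eqJ)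

  unlast-nothing : ∀ {n} (J : Fin (suc n)) → unlast Q J ≡ nothing → J ≡ fromℕ n
  unlast-nothing {zero}  zero    _  = refl
  unlast-nothing {suc n} (suc J) eq with unlast Q J in eqJ
  ... | nothing = cong suc (unlast-nothing J eqJ)

  _∼_ : Cell 1 → Cell 1 → Set
  _∼_ = _≈_ Q

  ∼-sym : ∀ {e e'} → e ∼ e' → e' ∼ e
  ∼-sym = symmetric (Gen Q)

  swapBelow : ∀ α β {n} {a b : Fin (suc (suc n))} (a≢b : a ≢ b) (b≢a : b ≢ a) → b < a →
              (x : Cell (suc (suc n))) →
              δ β n (punchOut a≢b) (δ α (suc n) a x) ≡ δ α n (punchOut b≢a) (δ β (suc n) b x)
  swapBelow α β {n} {a} {b} a≢b b≢a b<a x = begin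
    δ β n k (δ α (suc n) a x)            ≡⟨ cubical β α n k a ℓ x k<a ℓ≡a-1 ⟩
    δ α n ℓ (δ β (suc n) (inject₁ k) x)  ≡⟨ cong (λ c → δ α n ℓ (δ β (suc n) c x)) (inject₁-punchOut a≢b b<a) ⟩
    δ α n ℓ (δ β (suc n) b x)            ∎
    where
    open ≡-Reasoning
    k ℓ : Fin (suc n)
    k = punchOut a≢b
    ℓ = punchOut b≢a
    k<a : toℕ k <ℕ toℕ a
    k<a = subst (_<ℕ toℕ a)
            (trans (cong toℕ (sym (inject₁-punchOut a≢b b<a))) (toℕ-inject₁ k)) b<a
    ℓ≡a-1 : toℕ ℓ ≡ pred (toℕ a)
    ℓ≡a-1 = cong pred (suc-punchOut b≢a b<a)

  faceSwap : ∀ α β {n} {a b : Fin (suc (suc n))} (a≢b : a ≢ b) (b≢a : b ≢ a)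
             (x : Cell (suc (suc n))) →
             δ β n (punchOut a≢b) (δ α (suc n) a x) ≡ δ α n (punchOut b≢a) (δ β (suc n) b x)
  faceSwap α β {a = a} {b} a≢b b≢a x with <-cmp b a
  ... | tri< b<a _ _ = swapBelow α β a≢b b≢a b<a x
  ... | tri≈ _ b≡a _ = ⊥-elim (b≢a b≡a)
  ... | tri> _ _ a<b = sym (swapBelow β α b≢a a≢b a<b x)

  -- EdgeOf n J q e: the edge e arises from q ∈ Q_{n+1} by a composite of
  -- faces (of any kinds, in any order) keeping coordinate J.
  data EdgeOf : (n : ℕ) → Fin (suc n) → Cell (suc n) → Cell 1 → Set where
    here : ∀ {J e} → EdgeOf zero J e e
    face : ∀ {n} α (i : Fin (suc (suc n))) {j J} {q : Cell (suc (suc n))} {e} →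
           punchIn i j ≡ J → EdgeOf n j (δ α (suc n) i q) e → EdgeOf (suc n) J q e

  dropLower-isEdge : ∀ n (q : Cell (suc n)) → EdgeOf n (fromℕ n) q (dropLower Q n q)
  dropLower-isEdge zero    q = here
  dropLower-isEdge (suc n) q =
    face s (inject₁ (fromℕ n)) (punchIn-penultimate n) (dropLower-isEdge n _)

  faceEdge-isEdge : ∀ n (J : Fin (suc n)) (q : Cell (suc n)) → EdgeOf n J q (faceEdge Q n J q)
  faceEdge-isEdge zero    zero q = here
  faceEdge-isEdge (suc n) J    q with unlast Q J in eq
  ... | nothing = subst (λ K → EdgeOf (suc n) K q (dropLower Q (suc n) q))
                        (sym (unlast-nothing J eq)) (dropLower-isEdge (suc n) q)
  ... | just j  = face s (fromℕ (suc n)) (unlast-just J eq) (faceEdge-isEdge n j _)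

  Unique : ℕ → Set
  Unique n = ∀ {J q e e'} → EdgeOf n J q e → EdgeOf n J q e' → e ∼ e'

  toSource : ∀ α (i : Fin 2) (q : Cell 2) → δ α 1 i q ∼ δ s 1 i q
  toSource s i q = ε
  toSource t i q = bwd (gen q i) ◅ ε

  -- Two edges of q ∈ Q_{n+2} in direction J obtained through DIFFERENT faces
  -- i ≠ i' are ≈: both faces contain the common face obtained by removing i
  -- and i', and an edge of that face is an edge of each of them.
  crossFaces : ∀ {n} → Unique n → ∀ {α β} {i i' : Fin (suc (suc n))} {j j' J}
               {q : Cell (suc (suc n))} {e e'} → i ≢ i' → punchIn i j ≡ J → punchIn i' j' ≡ J →
               EdgeOf n j (δ α (suc n) i q) e → EdgeOf n j' (δ β (suc n) i' q) e' → e ∼ e'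
  -- A square has no two distinct faces keeping the same direction.
  crossFaces {zero}  _ {i = zero}     {zero}                   i≢i' _ _ _ _ = ⊥-elim (i≢i' refl)
  crossFaces {zero}  _ {i = zero}     {suc zero} {zero} {zero} _ refl () _ _
  crossFaces {zero}  _ {i = suc zero} {zero}     {zero} {zero} _ refl () _ _
  crossFaces {zero}  _ {i = suc zero} {suc zero}               i≢i' _ _ _ _ = ⊥-elim (i≢i' refl)
  crossFaces {suc m} u {α} {β} {i} {i'} {j} {j'} {J} {q} i≢i' eq eq' d d' =
    u d viaI ◅◅ ∼-sym (u d' viaI')
    where
    open ≡-Reasoning
    c c' : Fin (suc (suc m))
    c  = punchOut i≢i'              -- coordinate i' inside the face i
    c' = punchOut (i≢i' ∘ sym)      -- coordinate i inside the face i'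
    c≢j : c ≢ j
    c≢j c≡j = punchInᵢ≢i i' j' (begin
      punchIn i' j' ≡⟨ trans eq' (sym eq) ⟩
      punchIn i j   ≡⟨ cong (punchIn i) (sym c≡j) ⟩
      punchIn i c   ≡⟨ punchIn-punchOut i≢i' ⟩
      i'            ∎)
    k : Fin (suc m)
    k  = punchOut c≢j               -- direction J inside the common face
    r : Cell (suc m)
    r  = δ β (suc m) c (δ α (suc (suc m)) i q)
    e₀ : Cell 1
    e₀ = faceEdge Q m k r
    k-in-i' : punchIn c' k ≡ j'
    k-in-i' = punchIn-injective i' _ _ (begin
      punchIn i' (punchIn c' k) ≡⟨ sym (punchIn-commute i≢i' (i≢i' ∘ sym) k) ⟩
      punchIn i (punchIn c k)   ≡⟨ cong (punchIn i) (punchIn-punchOut c≢j) ⟩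
      punchIn i j               ≡⟨ trans eq (sym eq') ⟩
      punchIn i' j'             ∎)
    viaI : EdgeOf (suc m) j (δ α (suc (suc m)) i q) e₀
    viaI = face β c (punchIn-punchOut c≢j) (faceEdge-isEdge m k r)
    viaI' : EdgeOf (suc m) j' (δ β (suc (suc m)) i' q) e₀
    viaI' = face α c' k-in-i'
      (subst (λ x → EdgeOf m k x e₀) (faceSwap α β i≢i' (i≢i' ∘ sym) q) (faceEdge-isEdge m k r))

  -- Two edges obtained through the SAME face i (possibly of different kinds)
  -- are ≈: for a square this is a generator of ≈; in higher dimension both
  -- are compared, by 'crossFaces', with an edge through a third face K.
  sameFace : ∀ {n} → Unique n → ∀ {α β} {i : Fin (suc (suc n))} {j j' J}
             {q : Cell (suc (suc n))} {e e'} → punchIn i j ≡ J → punchIn i j' ≡ J →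
             EdgeOf n j (δ α (suc n) i q) e → EdgeOf n j' (δ β (suc n) i q) e' → e ∼ e'
  sameFace {zero} _ {α} {β} {i} {q = q} _ _ here here = toSource α i q ◅◅ ∼-sym (toSource β i q)
  sameFace {suc m} u {i = i} {j} {J = J} {q} eq eq' d d' =
    crossFaces u i≢K eq eqK d viaK ◅◅ ∼-sym (crossFaces u i≢K eq' eqK d' viaK)
    where
    K : Fin (suc (suc (suc m)))      -- a third coordinate, distinct from i and J
    K = punchIn i (punchIn j zero)
    i≢K : i ≢ K
    i≢K = punchInᵢ≢i i _ ∘ sym
    K≢J : K ≢ J
    K≢J K≡J = punchInᵢ≢i j zero (punchIn-injective i _ _ (trans K≡J (sym eq)))
    eqK : punchIn K (punchOut K≢J) ≡ J
    eqK = punchIn-punchOut K≢J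
    viaK : EdgeOf (suc m) (punchOut K≢J) (δ s (suc (suc m)) K q)
                  (faceEdge Q (suc m) (punchOut K≢J) (δ s (suc (suc m)) K q))
    viaK = faceEdge-isEdge (suc m) (punchOut K≢J) (δ s (suc (suc m)) K q)

  unique : ∀ n → Unique n
  unique zero    here            here               = ε
  unique (suc n) (face α i eq d) (face β i' eq' d') with i ≟ i'
  ... | yes refl = sameFace (unique n) eq eq' d d'
  ... | no i≢i'  = crossFaces (unique n) i≢i' eq eq' d d'

  faceLabel : ∀ {n} α (i : Fin (suc (suc n))) (j : Fin (suc n)) (q : Cell (suc (suc n))) →
              faceEdge Q n j (δ α (suc n) i q) ∼ faceEdge Q (suc n) (punchIn i j) q
  faceLabel α i j q = unique _ (face α i refl (faceEdge-isEdge _ j _)) (faceEdge-isEdge _ _ q)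

  S-closed : ∀ {n q} (π : RootedPath Q n q) {e e'} → e ∼ e' → Sπ Q π e → Sπ Q π e'
  S-closed root         e∼e' ()
  S-closed (up π i q _) e∼e' (inj₁ h) = inj₁ (S-closed π e∼e' h)
  S-closed (up π i q _) e∼e' (inj₂ h) = inj₂ (∼-sym e∼e' ◅◅ h)
  S-closed (down π i)   e∼e' h        = S-closed π e∼e' h

  LabelsInS : ∀ {n q} → RootedPath Q n q → Set
  LabelsInS {zero}      π = ⊤
  LabelsInS {suc n} {q} π = ∀ J → Sπ Q π (faceEdge Q n J q)

  -- An s-step into q adds the new label λ_i(q) and the others are labels of
  -- the face s_i q it came from; a t-step passes to a face, whose labels
  -- are labels of the cell it leaves.
  labelsInS : ∀ {n q} (π : RootedPath Q n q) → LabelsInS π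
  labelsInS root = tt
  labelsInS (up π i q refl) J with i ≟ J
  labelsInS (up π i q refl) J | yes refl = inj₂ ε
  labelsInS (up {zero} π zero q refl) zero | no i≢J = ⊥-elim (i≢J refl)
  labelsInS (up {suc n} π i q refl) J | no i≢J =
    inj₁ (S-closed π old∼new (labelsInS π j))
    where
    j : Fin (suc n)
    j = punchOut i≢J
    old∼new : faceEdge Q n j (δ s (suc n) i q) ∼ faceEdge Q (suc n) J q
    old∼new = subst (λ K → faceEdge Q n j (δ s (suc n) i q) ∼ faceEdge Q (suc n) K q)
                    (punchIn-punchOut i≢J) (faceLabel s i j q)
  labelsInS (down {zero} π i) = tt
  labelsInS (down {suc n} {q'} π i) j =
    S-closed π (∼-sym (faceLabel t i j q')) (labelsInS π (punchIn i j))

-- Proposition 4.11: every element of T_π is the label λ_i(q') of a cell q'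
-- left by a t-step, and that label already lies in S_π.
proposition4p11 : (Q : HDA) (n : ℕ) (q : HDA.Cell Q n) (π : RootedPath Q n q) →
    IsSTConfiguration Q (Sπ Q π) (Tπ Q π)
proposition4p11 Q _ _ root               e ()
proposition4p11 Q _ _ (up π _ _ _)       e e∈T        = inj₁ (proposition4p11 Q _ _ π e e∈T)
proposition4p11 Q _ _ (down π i)         e (inj₁ e∈T) = proposition4p11 Q _ _ π e e∈T
proposition4p11 Q _ _ (down π i)         e (inj₂ e≈λ) =
  S-closed π (∼-sym e≈λ) (labelsInS π i)
  where open Labels Q
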